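{- Every split graph is permutationally $1$-$11$-representable.
   Context: A split graph is a graph whose vertex set can be partitioned into a clique and an independent set. For a word $w$ and letters $x,y$, let $w|_{\{x,y\}}$ be the subsequence of $w$ of all occurrences of $x$ and $y$. A word $w$ over $V$ $1$-$11$-represents a graph $G=(V,E)$ if for all distinct $x,y\in V$, the total number of occurrences of the factors $xx$ and $yy$ in $w|_{\{x,y\}}$ is at most $1$ if and only if $xy\in E$. $G$ is permutationally $1$-$11$-representable if it has such a representing word that is a concatenation of (one or more) permutations of $V$ (words containing each vertex exactly once). -}

module Defs where

open import Data.Nat using (ℕ; zero; suc; _≤_)
open import Data.Bool using (Bool; true; false)
open import Data.Fin using (Fin; _≟_)
open import Data.Fin.Properties using ()
open import Data.List using (List; []; _∷_; filter; concat; allFin)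
open import Data.List.Relation.Binary.Permutation.Propositional using (_↭_)
open import Data.List.Relation.Unary.All using (All)
open import Data.Product using (Σ; _×_; ∃-syntax)
open import Data.Sum using (_⊎_)
open import Function.Bundles using (_⇔_)
open import Relation.Nullary using (¬_; yes; no)
open import Relation.Nullary.Decidable using (_⊎-dec_)
open import Relation.Binary.PropositionalEquality using (_≡_; _≢_)

record Graph (n : ℕ) : Set where
  field
    adj   : Fin n → Fin n → Bool
    sym   : ∀ x y → adj x y ≡ adj y x
    irrefl : ∀ x → adj x x ≡ false

open Graph public

Edge : ∀ {n} → Graph n → Fin n → Fin n → Set
Edge G x y = adj G x y ≡ true

IsSplit : ∀ {n} → Graph n → Set
IsSplit {n} G = Σ (Fin n → Bool) λ inK →
    (∀ x y → x ≢ y → inK x ≡ true → inK y ≡ true → Edge G x y)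
  × (∀ x y → inK x ≡ false → inK y ≡ false → ¬ Edge G x y)

restrict : ∀ {n} → List (Fin n) → Fin n → Fin n → List (Fin n)
restrict w x y = filter (λ z → (z ≟ x) ⊎-dec (z ≟ y)) w

-- number of positions i with w_i = w_{i+1}
-- (on a word over {x,y} this is the number of occurrences of the factors xx and yy)
repeatsFrom : ∀ {n} → Fin n → List (Fin n) → ℕ
repeatsFrom a [] = 0
repeatsFrom a (b ∷ w) with a ≟ b
... | yes _ = suc (repeatsFrom b w)
... | no _ = repeatsFrom b w

repeats : ∀ {n} → List (Fin n) → ℕ
repeats [] = 0
repeats (a ∷ w) = repeatsFrom a w

Represents111 : ∀ {n} → List (Fin n) → Graph n → Set
Represents111 w G =
  ∀ x y → x ≢ y → (repeats (restrict w x y) ≤ 1 ⇔ Edge G x y)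

IsPermutation : ∀ {n} → List (Fin n) → Set
IsPermutation {n} p = p ↭ allFin n

PermRep111 : ∀ {n} → Graph n → Set
PermRep111 {n} G =
  ∃[ p ] ∃[ ps ] (All IsPermutation (p ∷ ps) × Represents111 (concat (p ∷ ps)) G)

-- Restricted to two vertices x and y, a concatenation of permutations is a
-- sequence of blocks xy or yx, and its factors xx and yy are exactly the
-- switches between consecutive blocks.  Each permutation lists the clique
-- in index order, so clique pairs never switch; an independent vertex y is
-- placed by a cut into that chain.  All independent vertices start above the
-- clique, listed in increasing, decreasing and increasing index order (two
-- switches for every independent pair), and then sweep down past the clique
-- vertices one at a time.  When passing the clique vertex x, a neighbour y of
-- x crosses it once, while a non-neighbour goes below x, comes back above it
-- and goes below for good: one switch against three.

module Submission where

open import Defs renaming (sym to adj-sym)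
open import Data.Bool using (Bool; true; false; if_then_else_)
open import Data.Fin using (Fin; toℕ; fromℕ<; _≟_) renaming (_<_ to _<ᶠ_)
open import Data.Fin.Properties
  using (toℕ<n; fromℕ<-toℕ) renaming (<-cmp to <ᶠ-cmp; <⇒≢ to <ᶠ⇒≢)
open import Data.List using (List; []; _∷_; _++_; map; concat; allFin)
open import Data.List.Properties using (filter-++; filter-≐; map-cong; map-∘)
open import Data.List.Membership.Propositional using (_∈_)
open import Data.List.Membership.Propositional.Properties using (∈-filter⁺; ∈-filter⁻; ∈-allFin)
open import Data.List.Membership.Propositional.Properties.WithK using (unique∧set⇒bag)
open import Data.List.Relation.Binary.BagAndSetEquality using (∼bag⇒↭)
open import Data.List.Relation.Binary.Permutation.Propositional
  using (_↭_; ↭-refl; ↭-sym; ↭-trans; swap)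
open import Data.List.Relation.Binary.Permutation.Propositional.Properties
  using (∈-resp-↭; drop-∷; ↭-singleton-inv; ↭-length; filter-↭)
import Data.List.Relation.Unary.All as All
open import Data.List.Relation.Unary.All.Properties using (map⁺)
import Data.List.Relation.Unary.AllPairs as AllPairs
open import Data.List.Relation.Unary.Any using (here; there)
open import Data.List.Relation.Unary.Linked using (Linked; [-]; _∷_)
open import Data.List.Relation.Unary.Unique.Propositional.Properties
  using (allFin⁺) renaming (filter⁺ to unique-filter⁺)
import Data.List.Relation.Unary.Sorted.TotalOrder.Properties as Sorted
import Data.List.Sort as Sort
open import Data.Nat using (ℕ; zero; suc; _+_; _*_; _∸_; _≤_; _<_; z≤n; s≤s; s<s; _<?_)
open import Data.Nat.Properties
  using (≤-decTotalOrder; ≤-refl; ≤-trans; ≤-reflexive; <-irrefl; <⇒≱; ≮⇒≥; ≤⇒≯;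
         <-≤-trans; <⇒≤;
         m≤m+n; n≤1+n; m<1+n⇒m<n∨m≡n; *-suc; +-monoʳ-<; *-monoʳ-≤; *-monoʳ-<; ∸-monoʳ-<;
         module ≤-Reasoning)
open import Data.Product using (_,_)
open import Data.Sum using (_⊎_; inj₁; inj₂)
import Data.Sum as Sum
open import Function using (_∘_; const)
open import Function.Bundles using (_⇔_; mk⇔)
open import Relation.Binary.Bundles using (DecTotalOrder)
open import Relation.Binary.Definitions using (Symmetric; tri<; tri≈; tri>)
import Relation.Binary.Construct.On as On
open import Relation.Binary.PropositionalEquality
  using (_≡_; _≢_; refl; sym; trans; cong; cong₂; subst; subst₂; module ≡-Reasoning)
open import Relation.Nullary using (does; yes; no; contradiction)
open import Relation.Nullary.Decidable using (dec-true; dec-false; _⊎-dec_)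
open import Relation.Unary using (Decidable)
open import Level using (0ℓ)

↭-pair-inv : ∀ {A : Set} {x y : A} {zs : List A} →
  zs ↭ x ∷ y ∷ [] → zs ≡ x ∷ y ∷ [] ⊎ zs ≡ y ∷ x ∷ []
↭-pair-inv {zs = []} p with () ← ↭-length p
↭-pair-inv {zs = _ ∷ []} p with () ← ↭-length p
↭-pair-inv {zs = _ ∷ _ ∷ _ ∷ _} p with () ← ↭-length p
↭-pair-inv {x = x} {zs = a ∷ b ∷ []} p with ∈-resp-↭ (↭-sym p) (here refl)
... | here refl = inj₁ (cong (x ∷_) (↭-singleton-inv (drop-∷ p)))
... | there (here refl) =
  inj₂ (cong (_++ x ∷ []) (↭-singleton-inv (drop-∷ (↭-trans (swap x a ↭-refl) p))))

module _ {n : ℕ} where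

  endpoint? : (x y : Fin n) → Decidable (λ z → z ≡ x ⊎ z ≡ y)
  endpoint? x y z = (z ≟ x) ⊎-dec (z ≟ y)

  restrict-sym : ∀ w (x y : Fin n) → restrict w x y ≡ restrict w y x
  restrict-sym w x y = filter-≐ _ _ (Sum.swap , Sum.swap) w

  restrict-concatMap : ∀ {A : Set} (f : A → List (Fin n)) cs x y →
    restrict (concat (map f cs)) x y ≡ concat (map (λ c → restrict (f c) x y) cs)
  restrict-concatMap f [] x y = refl
  restrict-concatMap f (c ∷ cs) x y =
    trans (filter-++ _ (f c) _) (cong (restrict (f c) x y ++_) (restrict-concatMap f cs x y))

  restrict-allFin : ∀ {x y : Fin n} → x ≢ y → restrict (allFin n) x y ↭ x ∷ y ∷ []
  restrict-allFin {x} {y} x≢y = ∼bag⇒↭ (unique∧set⇒bag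
    (unique-filter⁺ (endpoint? x y) (allFin⁺ n))
    ((x≢y All.∷ All.[]) AllPairs.∷ All.[] AllPairs.∷ AllPairs.[])
    (mk⇔ to from))
    where
      to : ∀ {z} → z ∈ restrict (allFin n) x y → z ∈ x ∷ y ∷ []
      to z∈ with ∈-filter⁻ (endpoint? x y) {xs = allFin n} z∈
      ... | _ , inj₁ z≡x = here z≡x
      ... | _ , inj₂ z≡y = there (here z≡y)
      from : ∀ {z} → z ∈ x ∷ y ∷ [] → z ∈ restrict (allFin n) x y
      from {z} (here z≡x) = ∈-filter⁺ (endpoint? x y) (∈-allFin z) (inj₁ z≡x)
      from {z} (there (here z≡y)) = ∈-filter⁺ (endpoint? x y) (∈-allFin z) (inj₂ z≡y)

  restrict-↭ : ∀ {w} {x y : Fin n} → IsPermutation w → x ≢ y → restrict w x y ↭ x ∷ y ∷ []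
  restrict-↭ w↭ x≢y = ↭-trans (filter-↭ _ w↭) (restrict-allFin x≢y)

module _ {n : ℕ} (κ : Fin n → ℕ) where
  private
    order : DecTotalOrder 0ℓ 0ℓ 0ℓ
    order = On.decTotalOrder ≤-decTotalOrder κ
  open Sort order using (sort; sort-↭; sort-↗)

  orderBy : List (Fin n)
  orderBy = sort (allFin n)

  orderBy-↭ : IsPermutation orderBy
  orderBy-↭ = sort-↭ (allFin n)

  restrict-orderBy-< : ∀ {x y} → κ x < κ y → restrict orderBy x y ≡ x ∷ y ∷ []
  restrict-orderBy-< κx<κy with ↭-pair-inv (restrict-↭ orderBy-↭ λ { refl → <-irrefl refl κx<κy })
  ... | inj₁ eq = eq
  ... | inj₂ eq
    with subst (Linked _) eq (Sorted.filter⁺ (DecTotalOrder.totalOrder order) _ (sort-↗ (allFin n)))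
  ... | κy≤κx ∷ [-] = contradiction κy≤κx (<⇒≱ κx<κy)

  restrict-orderBy-> : ∀ {x y} → κ y < κ x → restrict orderBy x y ≡ y ∷ x ∷ []
  restrict-orderBy-> {x} {y} κy<κx = trans (restrict-sym orderBy x y) (restrict-orderBy-< κy<κx)

switches : Bool → List Bool → ℕ
switches b [] = 0
switches true (true ∷ bs) = switches true bs
switches true (false ∷ bs) = suc (switches false bs)
switches false (true ∷ bs) = suc (switches true bs)
switches false (false ∷ bs) = switches false bs

switches-const : ∀ {A : Set} b (cs : List A) → switches b (map (const b) cs) ≡ 0
switches-const b [] = refl
switches-const true (c ∷ cs) = switches-const true cs
switches-const false (c ∷ cs) = switches-const false cs

switches-detour : ∀ a bs → switches false bs ≡ 0 →
  switches true (a ∷ true ∷ false ∷ bs) ≡ (if a then 1 else 3)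
switches-detour true bs none = cong suc none
switches-detour false bs none = cong (3 +_) none

module _ {n : ℕ} where

  orderedPair : Fin n → Fin n → Bool → List (Fin n)
  orderedPair x y true = x ∷ y ∷ []
  orderedPair x y false = y ∷ x ∷ []

  repeatsFrom-≡ : ∀ (a : Fin n) w → repeatsFrom a (a ∷ w) ≡ suc (repeatsFrom a w)
  repeatsFrom-≡ a w with a ≟ a
  ... | yes _ = refl
  ... | no a≢a = contradiction refl a≢a

  repeatsFrom-≢ : ∀ {a b : Fin n} w → a ≢ b → repeatsFrom a (b ∷ w) ≡ repeatsFrom b w
  repeatsFrom-≢ {a} {b} w a≢b with a ≟ b
  ... | yes a≡b = contradiction a≡b a≢b
  ... | no _ = refl

  repeatsFrom-++ : ∀ (a : Fin n) u v → repeatsFrom a u ≤ repeatsFrom a (u ++ v)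
  repeatsFrom-++ a [] v = z≤n
  repeatsFrom-++ a (b ∷ u) v with a ≟ b
  ... | yes _ = s≤s (repeatsFrom-++ b u v)
  ... | no _ = repeatsFrom-++ b u v

  repeats-++ : ∀ (u v : List (Fin n)) → repeats u ≤ repeats (u ++ v)
  repeats-++ [] v = z≤n
  repeats-++ (a ∷ u) v = repeatsFrom-++ a u v

  module _ {x y : Fin n} (x≢y : x ≢ y) where
    private
      y≢x : y ≢ x
      y≢x = x≢y ∘ sym

      lastOf : Bool → Fin n
      lastOf true = y
      lastOf false = x

      repeatsFrom-orderedPairs : ∀ b bs →
        repeatsFrom (lastOf b) (concat (map (orderedPair x y) bs)) ≡ switches b bs
      repeatsFrom-orderedPairs b [] = refl
      repeatsFrom-orderedPairs true (true ∷ bs) =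
        trans (repeatsFrom-≢ _ y≢x) (trans (repeatsFrom-≢ _ x≢y) (repeatsFrom-orderedPairs true bs))
      repeatsFrom-orderedPairs true (false ∷ bs) =
        trans (repeatsFrom-≡ y _)
              (cong suc (trans (repeatsFrom-≢ _ y≢x) (repeatsFrom-orderedPairs false bs)))
      repeatsFrom-orderedPairs false (true ∷ bs) =
        trans (repeatsFrom-≡ x _)
              (cong suc (trans (repeatsFrom-≢ _ x≢y) (repeatsFrom-orderedPairs true bs)))
      repeatsFrom-orderedPairs false (false ∷ bs) =
        trans (repeatsFrom-≢ _ x≢y) (trans (repeatsFrom-≢ _ y≢x) (repeatsFrom-orderedPairs false bs))

    repeats-orderedPairs : ∀ b bs → repeats (concat (map (orderedPair x y) (b ∷ bs))) ≡ switches b bs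
    repeats-orderedPairs true bs = trans (repeatsFrom-≢ _ x≢y) (repeatsFrom-orderedPairs true bs)
    repeats-orderedPairs false bs = trans (repeatsFrom-≢ _ y≢x) (repeatsFrom-orderedPairs false bs)

m<n⇒1+2m<2n : ∀ {m n} → m < n → suc (2 * m) < 2 * n
m<n⇒1+2m<2n {m} m<n = ≤-trans (≤-reflexive (sym (*-suc 2 m))) (*-monoʳ-≤ 2 m<n)

m≤n⇒2m<1+2n : ∀ {m n} → m ≤ n → 2 * m < suc (2 * n)
m≤n⇒2m<1+2n m≤n = s≤s (*-monoʳ-≤ 2 m≤n)

≤1⇔if1else3 : ∀ {r} (a : Bool) → r ≡ (if a then 1 else 3) → (r ≤ 1 ⇔ a ≡ true)
≤1⇔if1else3 true r≡1 = mk⇔ (const refl) (const (≤-reflexive r≡1))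
≤1⇔if1else3 false refl = mk⇔ (λ { (s≤s ()) }) (λ ())

on-ordered-pairs : ∀ {n} (P : Fin n → Fin n → Set) → Symmetric P →
  (∀ {x y} → x <ᶠ y → P x y) → ∀ {x y} → x ≢ y → P x y
on-ordered-pairs P P-sym P< {x} {y} x≢y with <ᶠ-cmp x y
... | tri< x<y _ _ = P< x<y
... | tri≈ _ x≡y _ = contradiction x≡y x≢y
... | tri> _ _ y<x = P-sym (P< y<x)

module Sweep {n : ℕ} (G : Graph n) (inK : Fin n → Bool) where

  adjAt : ℕ → Fin n → Bool
  adjAt j y with j <? n
  ... | yes j<n = adj G (fromℕ< j<n) y
  ... | no _ = false

  adjAt-toℕ : ∀ x y → adjAt (toℕ x) y ≡ adj G x y
  adjAt-toℕ x y with toℕ x <? n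
  ... | yes x<n = cong (λ v → adj G v y) (fromℕ<-toℕ x x<n)
  ... | no x≮n = contradiction (toℕ<n x) x≮n

  -- An independent vertex z with cut c z lies between the clique vertices of
  -- index below c z and the others.
  layout : (Fin n → ℕ) → Fin n → ℕ
  layout cut z = if inK z then suc (2 * toℕ z) else 2 * cut z

  layout-clique : ∀ cut {z} → inK z ≡ true → layout cut z ≡ suc (2 * toℕ z)
  layout-clique cut {z} inK-z = cong (if_then suc (2 * toℕ z) else 2 * cut z) inK-z

  layout-independent : ∀ cut {z} → inK z ≡ false → layout cut z ≡ 2 * cut z
  layout-independent cut {z} inK-z = cong (if_then suc (2 * toℕ z) else 2 * cut z) inK-z

  layout-independent-< : ∀ cut {u v} → inK u ≡ false → inK v ≡ false →
    cut u < cut v → layout cut u < layout cut v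
  layout-independent-< cut Iu Iv cu<cv =
    subst₂ _<_ (sym (layout-independent cut Iu)) (sym (layout-independent cut Iv)) (*-monoʳ-< 2 cu<cv)

  ascending descending : Fin n → ℕ
  ascending y = n + toℕ y
  descending y = n + (n ∸ toℕ y)

  detour : ℕ → Fin n → ℕ
  detour j y = if adjAt j y then suc j else j

  sweep : ℕ → List (Fin n → ℕ)
  sweep zero = []
  sweep (suc j) = detour j ∷ const (suc j) ∷ const j ∷ sweep j

  cuts : List (Fin n → ℕ)
  cuts = ascending ∷ descending ∷ ascending ∷ sweep n

  word : List (Fin n)
  word = concat (map (orderBy ∘ layout) cuts)

  word-permutations : All.All IsPermutation (map (orderBy ∘ layout) cuts)
  word-permutations = map⁺ (All.universal (orderBy-↭ ∘ layout) cuts)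

  restrict-word : ∀ x y →
    restrict word x y ≡ concat (map (λ c → restrict (orderBy (layout c)) x y) cuts)
  restrict-word = restrict-concatMap (orderBy ∘ layout) cuts

  repeats-word : ∀ {x y} → x ≢ y → (side : (Fin n → ℕ) → Bool) →
    (∀ c → restrict (orderBy (layout c)) x y ≡ orderedPair x y (side c)) →
    repeats (restrict word x y)
      ≡ switches (side ascending) (map side (descending ∷ ascending ∷ sweep n))
  repeats-word {x} {y} x≢y side pairs = begin
    repeats (restrict word x y)
      ≡⟨ cong repeats (restrict-word x y) ⟩
    repeats (concat (map (λ c → restrict (orderBy (layout c)) x y) cuts))
      ≡⟨ cong (repeats ∘ concat) (trans (map-cong pairs cuts) (map-∘ {g = orderedPair x y} cuts)) ⟩
    repeats (concat (map (orderedPair x y) (map side cuts)))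
      ≡⟨ repeats-orderedPairs x≢y (side ascending) (map side (descending ∷ ascending ∷ sweep n)) ⟩
    switches (side ascending) (map side (descending ∷ ascending ∷ sweep n)) ∎
    where open ≡-Reasoning

  repeats-clique : ∀ {x y} → x ≢ y → inK x ≡ true → inK y ≡ true →
    repeats (restrict word x y) ≡ 0
  repeats-clique = on-ordered-pairs P P-sym P<
    where
      P : Fin n → Fin n → Set
      P x y = inK x ≡ true → inK y ≡ true → repeats (restrict word x y) ≡ 0
      P-sym : Symmetric P
      P-sym {x} {y} Pxy Ky Kx = trans (cong repeats (restrict-sym word y x)) (Pxy Kx Ky)
      P< : ∀ {x y} → x <ᶠ y → P x y
      P< {x} {y} x<y Kx Ky =
        trans (repeats-word x≢y (const true) pairs)
              (switches-const true (descending ∷ ascending ∷ sweep n))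
        where
          x≢y : x ≢ y
          x≢y = <ᶠ⇒≢ x<y
          pairs : ∀ c → restrict (orderBy (layout c)) x y ≡ x ∷ y ∷ []
          pairs c = restrict-orderBy-< (layout c)
            (subst₂ _<_ (sym (layout-clique c Kx)) (sym (layout-clique c Ky)) (s<s (*-monoʳ-< 2 x<y)))

  repeats-independent : ∀ {x y} → x ≢ y → inK x ≡ false → inK y ≡ false →
    2 ≤ repeats (restrict word x y)
  repeats-independent = on-ordered-pairs P P-sym P<
    where
      P : Fin n → Fin n → Set
      P x y = inK x ≡ false → inK y ≡ false → 2 ≤ repeats (restrict word x y)
      P-sym : Symmetric P
      P-sym {x} {y} Pxy Iy Ix = subst (λ w → 2 ≤ repeats w) (restrict-sym word x y) (Pxy Ix Iy)
      P< : ∀ {x y} → x <ᶠ y → P x y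
      P< {x} {y} x<y Ix Iy = begin
        2                           ≡⟨ repeats-orderedPairs x≢y true (false ∷ true ∷ []) ⟨
        repeats zigzag              ≤⟨ repeats-++ zigzag later ⟩
        repeats (zigzag ++ later)   ≡⟨ cong repeats prefix ⟨
        repeats (restrict word x y) ∎
        where
          open ≤-Reasoning
          x≢y : x ≢ y
          x≢y = <ᶠ⇒≢ x<y
          zigzag later : List (Fin n)
          zigzag = x ∷ y ∷ y ∷ x ∷ x ∷ y ∷ []
          later = concat (map (λ c → restrict (orderBy (layout c)) x y) (sweep n))
          asc : restrict (orderBy (layout ascending)) x y ≡ x ∷ y ∷ []
          asc = restrict-orderBy-< (layout ascending)
            (layout-independent-< ascending Ix Iy (+-monoʳ-< n x<y))
          desc : restrict (orderBy (layout descending)) x y ≡ y ∷ x ∷ []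
          desc = restrict-orderBy-> (layout descending)
            (layout-independent-< descending Iy Ix (+-monoʳ-< n (∸-monoʳ-< x<y (<⇒≤ (toℕ<n y)))))
          prefix : restrict word x y ≡ zigzag ++ later
          prefix = trans (restrict-word x y) (cong₂ (λ a d → a ++ d ++ a ++ later) asc desc)

  detour-≥ : ∀ j y → j ≤ detour j y
  detour-≥ j y with adjAt j y
  ... | true = n≤1+n j
  ... | false = ≤-refl

  detour-≤ : ∀ j y → detour j y ≤ suc j
  detour-≤ j y with adjAt j y
  ... | true = ≤-refl
  ... | false = n≤1+n j

  module _ (i : ℕ) (y : Fin n) where

    precedes : (Fin n → ℕ) → Bool
    precedes cut = does (i <? cut y)

    precedes-detour : precedes (detour i) ≡ adjAt i y
    precedes-detour with adjAt i y
    ... | true = dec-true (i <? suc i) ≤-refl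
    ... | false = dec-false (i <? i) (<-irrefl refl)

    switches-sweep-≤ : ∀ m → m ≤ i → switches false (map precedes (sweep m)) ≡ 0
    switches-sweep-≤ zero _ = refl
    switches-sweep-≤ (suc j) j<i
      rewrite dec-false (i <? detour j y) (≤⇒≯ (≤-trans (detour-≤ j y) j<i))
            | dec-false (i <? suc j) (≤⇒≯ j<i)
            | dec-false (i <? j) (≤⇒≯ (<⇒≤ j<i))
      = switches-sweep-≤ j (<⇒≤ j<i)

    switches-sweep-> : ∀ m → i < m →
      switches true (map precedes (sweep m)) ≡ (if adjAt i y then 1 else 3)
    switches-sweep-> (suc j) i<1+j with m<1+n⇒m<n∨m≡n i<1+j
    ... | inj₁ i<j
      rewrite dec-true (i <? detour j y) (<-≤-trans i<j (detour-≥ j y))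
            | dec-true (i <? suc j) i<1+j
            | dec-true (i <? j) i<j
      = switches-sweep-> j i<j
    ... | inj₂ refl
      rewrite precedes-detour
            | dec-true (i <? suc i) ≤-refl
            | dec-false (i <? i) (<-irrefl refl)
      = switches-detour (adjAt i y) _ (switches-sweep-≤ i ≤-refl)

  repeats-cross : ∀ {x y} → inK x ≡ true → inK y ≡ false →
    repeats (restrict word x y) ≡ (if adj G x y then 1 else 3)
  repeats-cross {x} {y} Kx Iy = begin
    repeats (restrict word x y)
      ≡⟨ repeats-word x≢y (precedes i y) pairs ⟩
    switches (precedes i y ascending) (map (precedes i y) (descending ∷ ascending ∷ sweep n))
      ≡⟨ leading ⟩
    switches true (map (precedes i y) (sweep n))
      ≡⟨ switches-sweep-> i y n (toℕ<n x) ⟩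
    (if adjAt i y then 1 else 3)
      ≡⟨ cong (if_then 1 else 3) (adjAt-toℕ x y) ⟩
    (if adj G x y then 1 else 3) ∎
    where
      open ≡-Reasoning
      i : ℕ
      i = toℕ x
      x≢y : x ≢ y
      x≢y refl = contradiction (trans (sym Kx) Iy) λ ()
      pairs : ∀ c → restrict (orderBy (layout c)) x y ≡ orderedPair x y (precedes i y c)
      pairs c with i <? c y
      ... | yes i<c rewrite dec-true (i <? c y) i<c = restrict-orderBy-< (layout c)
        (subst₂ _<_ (sym (layout-clique c Kx)) (sym (layout-independent c Iy)) (m<n⇒1+2m<2n i<c))
      ... | no i≮c rewrite dec-false (i <? c y) i≮c = restrict-orderBy-> (layout c)
        (subst₂ _<_ (sym (layout-independent c Iy)) (sym (layout-clique c Kx))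
                    (m≤n⇒2m<1+2n (≮⇒≥ i≮c)))
      leading : switches (precedes i y ascending) (map (precedes i y) (descending ∷ ascending ∷ sweep n))
              ≡ switches true (map (precedes i y) (sweep n))
      leading
        rewrite dec-true (i <? ascending y) (≤-trans (toℕ<n x) (m≤m+n n (toℕ y)))
              | dec-true (i <? descending y) (≤-trans (toℕ<n x) (m≤m+n n (n ∸ toℕ y)))
        = refl

mainTheorem7 : ∀ (n : ℕ) (G : Graph n) → IsSplit G → PermRep111 G
mainTheorem7 n G (inK , clique , independent) = _ , _ , word-permutations , represents
  where
    open Sweep G inK
    represents : Represents111 word G
    represents x y x≢y with inK x in Kx | inK y in Ky
    ... | true | true =
      mk⇔ (const (clique x y x≢y Kx Ky)) (const (subst (_≤ 1) (sym (repeats-clique x≢y Kx Ky)) z≤n))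
    ... | false | false =
      mk⇔ (λ r≤1 → contradiction (≤-trans (repeats-independent x≢y Kx Ky) r≤1) λ { (s≤s ()) })
          (λ xy → contradiction xy (independent x y Kx Ky))
    ... | true | false = ≤1⇔if1else3 (adj G x y) (repeats-cross Kx Ky)
    ... | false | true = ≤1⇔if1else3 (adj G x y)
      (trans (cong repeats (restrict-sym word x y))
      (trans (repeats-cross Ky Kx) (cong (if_then 1 else 3) (adj-sym G y x))))
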